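{- Let $S$ and $S'$ each be either an internal component of $T \setminus (D \setminus \widehat{D})$ or a vertex of $\widehat{D} \setminus D$. Then $S$ and $S'$ are connected in $G \setminus D$ if and only if their representatives $S_{\mathcal{M}}$ and $S'_{\mathcal{M}}$ (namely $r_S$ if $S$ is an internal component, and $S$ itself if $S$ is a vertex of $\widehat{D}\setminus D$) are connected in the graph $\mathcal{M}$.
   Context: Let $G=(V,E)$ be an undirected graph, let $\widehat{D}, D \subseteq V$, and assume $G \setminus \widehat{D}$ (the subgraph induced on $V \setminus \widehat{D}$) is connected. Let $T$ be a DFS tree of $G \setminus \widehat{D}$ rooted at some vertex $r$; every edge of $G\setminus\widehat{D}$ not in $T$ is a back-edge (joins an ancestor–descendant pair of $T$). Removing the vertices of $D \setminus \widehat{D}$ from $T$ splits it into connected components (subtrees); each component $C$ has a root $r_C$ (its vertex closest to $r$). A component $C$ is a hanging subtree if no vertex of $D \setminus \widehat{D}$ is a descendant of $r_C$ in $T$; otherwise $C$ is an internal component. A component $C$ is an ancestor of a component $C'$ if $r_C$ is an ancestor of $r_{C'}$ in $T$. The graph $\mathcal{M}$ has vertex set $(\widehat{D} \setminus D) \cup \{r_C : C \text{ an internal component of } T \setminus (D\setminus\widehat{D})\}$ and the following edges: (1) $r_{C_1}r_{C_2}$ whenever a back-edge of $G$ connects internal components $C_1, C_2$; (2) whenever a hanging subtree $H$ is connected by back-edges to internal components $C_1,\dots,C_k$, with $C_k$ an ancestor of all of $C_1,\dots,C_{k-1}$, the edges $r_{C_k}r_{C_1},\dots,r_{C_k}r_{C_{k-1}}$;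 (3) $u_1u_2$ whenever $u_1,u_2 \in \widehat{D}\setminus D$ are adjacent in $G$; (4) $r_C u$ whenever an edge of $G$ joins internal component $C$ and $u \in \widehat{D}\setminus D$; (5) $u_1u_2$ whenever $u_1,u_2 \in \widehat{D}\setminus D$ both have an edge of $G$ to a common hanging subtree $H$; (6) $r_C u$ whenever $C$ is an internal component, $u\in \widehat{D}\setminus D$, and there is a hanging subtree $H$ such that a back-edge connects $C$ and $H$ and an edge of $G$ connects $u$ and $H$. -}

module Defs where

open import Data.Nat using (ℕ)
open import Data.Fin using (Fin)
open import Data.Fin.Subset using (Subset; _∈_; _∉_)
open import Data.Product using (Σ; ∃; ∃-syntax; _×_; _,_)
open import Data.Sum using (_⊎_)
open import Relation.Nullary using (¬_; Dec)
open import Relation.Binary.PropositionalEquality using (_≡_; _≢_)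

record Graph (n : ℕ) : Set₁ where
  field
    Adj    : Fin n → Fin n → Set
    adj?   : ∀ u v → Dec (Adj u v)
    sym    : ∀ {u v} → Adj u v → Adj v u
    irrefl : ∀ {u} → ¬ Adj u u
open Graph public

-- Walks in G \ Y (the subgraph induced on V \ Y): every vertex of the walk
-- avoids Y and consecutive vertices are adjacent in G.
data Walk {n} (G : Graph n) (Y : Subset n) : Fin n → Fin n → Set where
  stop : ∀ {u} → u ∉ Y → Walk G Y u u
  step : ∀ {u w v} → u ∉ Y → Adj G u w → Walk G Y w v → Walk G Y u v

data Anc {n} (r : Fin n) (par : Fin n → Fin n) (a : Fin n) : Fin n → Set where
  here : Anc r par a a
  up   : ∀ {v} → v ≢ r → Anc r par a (par v) → Anc r par a v

record DFSTree {n} (G : Graph n) (D̂ : Subset n) : Set where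
  field
    root     : Fin n
    root∉    : root ∉ D̂
    par      : Fin n → Fin n
    par∉     : ∀ v → v ∉ D̂ → v ≢ root → par v ∉ D̂
    par-adj  : ∀ v → v ∉ D̂ → v ≢ root → Adj G v (par v)
    spanning : ∀ v → v ∉ D̂ → Anc root par root v
    dfs      : ∀ u v → u ∉ D̂ → v ∉ D̂ → Adj G u v →
               Anc root par u v ⊎ Anc root par v u
open DFSTree public

ConnectedMinus : ∀ {n} → Graph n → Subset n → Set
ConnectedMinus G Y = ∀ u v → u ∉ Y → v ∉ Y → Walk G Y u v

module Setup {n} (G : Graph n) (D̂ D : Subset n) (T : DFSTree G D̂) where

  r : Fin n
  r = root T

  p : Fin n → Fin n
  p = par T

  AncT : Fin n → Fin n → Set
  AncT = Anc r p

  TreeEdge : Fin n → Fin n → Set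
  TreeEdge u v = (u ≢ r × p u ≡ v) ⊎ (v ≢ r × p v ≡ u)

  BackEdge : Fin n → Fin n → Set
  BackEdge u v = u ∉ D̂ × v ∉ D̂ × Adj G u v × ¬ TreeEdge u v

  InX : Fin n → Set
  InX v = v ∈ D × v ∉ D̂

  InTX : Fin n → Set
  InTX v = v ∉ D̂ × ¬ InX v

  -- root of a component of T \ (D \ D̂): a vertex of T \ X whose parent
  -- (if any) is not in T \ X, i.e. the vertex of its component closest to r.
  IsCompRoot : Fin n → Set
  IsCompRoot c = InTX c × (c ≡ r ⊎ (c ≢ r × ¬ InTX (p c)))

  data UpPath (c : Fin n) : Fin n → Set where
    top  : InTX c → UpPath c c
    climb : ∀ {v} → InTX v → v ≢ r → UpPath c (p v) → UpPath c v

  InComp : Fin n → Fin n → Set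
  InComp c v = IsCompRoot c × UpPath c v

  Internal : Fin n → Set
  Internal c = IsCompRoot c × (∃[ x ] (InX x × AncT c x))

  Hanging : Fin n → Set
  Hanging c = IsCompRoot c × (∀ x → InX x → ¬ AncT c x)

  InD̂D : Fin n → Set
  InD̂D u = u ∈ D̂ × u ∉ D

  BackConn : Fin n → Fin n → Set
  BackConn c c' = ∃[ u ] ∃[ v ] (InComp c u × InComp c' v × BackEdge u v)

  EdgeTo : Fin n → Fin n → Set
  EdgeTo u h = ∃[ v ] (InComp h v × Adj G u v)

  -- the (directed presentation of the) edges of 𝓜, items (1)–(6)
  data MEdge : Fin n → Fin n → Set where
    e1 : ∀ {c₁ c₂} → Internal c₁ → Internal c₂ → BackConn c₁ c₂ → MEdge c₁ c₂
    e2 : ∀ {h cₖ c} → Hanging h → Internal cₖ → Internal c →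
         BackConn h cₖ → BackConn h c →
         (∀ c' → Internal c' → BackConn h c' → AncT cₖ c') →
         c ≢ cₖ → MEdge cₖ c
    e3 : ∀ {u₁ u₂} → InD̂D u₁ → InD̂D u₂ → Adj G u₁ u₂ → MEdge u₁ u₂
    e4 : ∀ {c u} → Internal c → InD̂D u → EdgeTo u c → MEdge c u
    e5 : ∀ {u₁ u₂ h} → InD̂D u₁ → InD̂D u₂ → Hanging h →
         EdgeTo u₁ h → EdgeTo u₂ h → MEdge u₁ u₂
    e6 : ∀ {c u h} → Internal c → InD̂D u → Hanging h →
         BackConn c h → EdgeTo u h → MEdge c u

  IsMVertex : Fin n → Set
  IsMVertex x = InD̂D x ⊎ Internal x

  data MConn : Fin n → Fin n → Set where
    mstop : ∀ {x} → IsMVertex x → MConn x x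
    mstep : ∀ {x y z} → (MEdge x y ⊎ MEdge y x) → MConn y z → MConn x z

  data Piece : Set where
    comp  : (c : Fin n) → Internal c → Piece
    dvert : (u : Fin n) → InD̂D u → Piece

  rep : Piece → Fin n
  rep (comp c _)  = c
  rep (dvert u _) = u

  _∈P_ : Fin n → Piece → Set
  v ∈P comp c _  = InComp c v
  v ∈P dvert u _ = v ≡ u

  ConnInGminusD : Piece → Piece → Set
  ConnInGminusD S S' = ∃[ s ] ∃[ s' ] (s ∈P S × s' ∈P S' × Walk G D s s')

module Submission where

open import Defs
open import Data.Fin using (Fin)
open import Data.Fin.Subset using (Subset; _∉_)
open import Data.Fin.Subset.Properties using (_∈?_)
open import Data.Fin.Properties using (_≟_; any?)
open import Data.Product using (∃-syntax; _×_; _,_; proj₁; proj₂)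
open import Data.Sum using (_⊎_; inj₁; inj₂; swap)
open import Data.Empty using (⊥-elim)
open import Relation.Nullary using (¬_; Dec; yes; no)
open import Relation.Nullary.Decidable using (_×-dec_; _⊎-dec_; ¬?; decidable-stable)
open import Relation.Unary using (Decidable)
open import Relation.Binary.PropositionalEquality using (_≡_; _≢_; refl; subst) renaming (sym to ≡-sym)
open import Function.Bundles using (_⇔_; mk⇔)

-- Every 𝓜-edge is realised by a walk in G \ D, since components of T \ (D \ D̂) are
-- subtrees avoiding D; this gives "if".  Conversely, follow a walk of G \ D: each of
-- its vertices lies in D̂ \ D, in an internal component or in a hanging subtree.  By the
-- DFS property an edge between two distinct components joins a component C to a
-- component below a vertex of D \ D̂ that descends from r_C; hence hanging subtrees are
-- pairwise non-adjacent, so a walk that enters a hanging subtree H stays in it until it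
-- reaches D̂ \ D or an internal component, and every internal component back-connected
-- to H is an ancestor of H.  The pieces before and after H are therefore joined by an
-- edge (5) or (6), or by edges (2) through the topmost internal component back-connected to H.

module _ {n} {G : Graph n} {Y : Subset n} where

  Walk-source∉ : ∀ {u v} → Walk G Y u v → u ∉ Y
  Walk-source∉ (stop u∉) = u∉
  Walk-source∉ (step u∉ _ _) = u∉

  infixr 5 _++ʷ_

  _++ʷ_ : ∀ {u v w} → Walk G Y u v → Walk G Y v w → Walk G Y u w
  stop _ ++ʷ q = q
  step u∉ a p ++ʷ q = step u∉ a (p ++ʷ q)

  reverseʷ : ∀ {u v} → Walk G Y u v → Walk G Y v u
  reverseʷ (stop u∉) = stop u∉
  reverseʷ (step u∉ a p) = reverseʷ p ++ʷ step (Walk-source∉ p) (Graph.sym G a) (stop u∉)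

module _ {n} {r : Fin n} {par : Fin n → Fin n} where

  Anc-trans : ∀ {a b c} → Anc r par a b → Anc r par b c → Anc r par a c
  Anc-trans ab here = ab
  Anc-trans ab (up ne bc) = up ne (Anc-trans ab bc)

  Anc-root : ∀ {a} → Anc r par a r → a ≡ r
  Anc-root here = refl
  Anc-root (up r≢r _) = ⊥-elim (r≢r refl)

  anc? : ∀ a {x} → Anc r par r x → Dec (Anc r par a x)
  anc? a here with a ≟ r
  ... | yes refl = yes here
  ... | no a≢r = no λ { here → a≢r refl ; (up r≢r _) → r≢r refl }
  anc? a {x} (up x≢r chain) with a ≟ x | anc? a chain
  ... | yes refl | _ = yes here
  ... | no a≢x | yes a≤px = yes (up x≢r a≤px)
  ... | no a≢x | no a≰px = no λ { here → a≢x refl ; (up _ a≤px) → a≰px a≤px }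

  data Topmost (P : Fin n → Set) (x : Fin n) : Set where
    topmost : ∀ c → P c → Anc r par c x →
              (∀ c' → P c' → Anc r par c' x → Anc r par c c') → Topmost P x
    none    : (∀ c → P c → ¬ Anc r par c x) → Topmost P x

  topmost? : ∀ {P} → Decidable P → ∀ {x} → Anc r par r x → Topmost P x
  topmost? P? here with P? r
  ... | yes Pr = topmost r Pr here λ c' _ c'≤r → subst (Anc r par r) (≡-sym (Anc-root c'≤r)) here
  ... | no ¬Pr = none λ c Pc c≤r → ¬Pr (subst _ (Anc-root c≤r) Pc)
  topmost? P? {x} (up x≢r chain) with topmost? P? chain | P? x
  ... | topmost c Pc c≤px below | _ =
        topmost c Pc (up x≢r c≤px) λ { c' _ here → up x≢r c≤px ; c' Pc' (up _ c'≤px) → below c' Pc' c'≤px }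
  ... | none above | yes Px =
        topmost x Px here λ { c' _ here → here ; c' Pc' (up _ c'≤px) → ⊥-elim (above c' Pc' c'≤px) }
  ... | none above | no ¬Px = none λ { c Pc here → ¬Px Pc ; c Pc (up _ c≤px) → above c Pc c≤px }

module Reduction {n} (G : Graph n) (D̂ D : Subset n) (T : DFSTree G D̂) where
  open Setup G D̂ D T

  W : Fin n → Fin n → Set
  W = Walk G D

  HasXBelow : Fin n → Set
  HasXBelow c = ∃[ x ] (InX x × AncT c x)

  Hanging⇒¬HasXBelow : ∀ {h} → Hanging h → ¬ HasXBelow h
  Hanging⇒¬HasXBelow (_ , noX) (x , x∈X , h≤x) = noX x x∈X h≤x

  ¬Internal×Hanging : ∀ {c} → Internal c → ¬ Hanging c
  ¬Internal×Hanging (_ , xBelow) hc = Hanging⇒¬HasXBelow hc xBelow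

  InTX⇒∉D : ∀ {v} → InTX v → v ∉ D
  InTX⇒∉D (v∉D̂ , v∉X) v∈D = v∉X (v∈D , v∉D̂)

  UpPath⇒InTX : ∀ {c v} → UpPath c v → InTX v
  UpPath⇒InTX (top v∈) = v∈
  UpPath⇒InTX (climb v∈ _ _) = v∈

  InComp⇒InTX : ∀ {c v} → InComp c v → InTX v
  InComp⇒InTX (_ , path) = UpPath⇒InTX path

  compRoot∉D̂ : ∀ {c} → IsCompRoot c → c ∉ D̂
  compRoot∉D̂ ((c∉D̂ , _) , _) = c∉D̂

  UpPath⇒Anc : ∀ {c v} → UpPath c v → AncT c v
  UpPath⇒Anc (top _) = here
  UpPath⇒Anc (climb _ v≢r path) = up v≢r (UpPath⇒Anc path)

  UpPath⇒Walk : ∀ {c v} → UpPath c v → W v c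
  UpPath⇒Walk (top c∈) = stop (InTX⇒∉D c∈)
  UpPath⇒Walk (climb {v} v∈ v≢r path) =
    step (InTX⇒∉D v∈) (par-adj T v (proj₁ v∈) v≢r) (UpPath⇒Walk path)

  InComp-walk : ∀ {c a b} → InComp c a → InComp c b → W a b
  InComp-walk (_ , pa) (_ , pb) = UpPath⇒Walk pa ++ʷ reverseʷ (UpPath⇒Walk pb)

  inX? : ∀ x → Dec (InX x)
  inX? x = (x ∈? D) ×-dec ¬? (x ∈? D̂)

  inTX? : ∀ x → Dec (InTX x)
  inTX? x = ¬? (x ∈? D̂) ×-dec ¬? (inX? x)

  compRoot-parent∉TX : ∀ {c} → IsCompRoot c → c ≢ r → ¬ InTX (p c)
  compRoot-parent∉TX (_ , inj₁ c≡r) c≢r _ = c≢r c≡r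
  compRoot-parent∉TX (_ , inj₂ (_ , pc∉TX)) _ = pc∉TX

  compRoot-parent∈X : ∀ {c} → IsCompRoot c → c ≢ r → InX (p c)
  compRoot-parent∈X {c} rc c≢r = decidable-stable (inX? (p c)) λ pc∉X →
    compRoot-parent∉TX rc c≢r (par∉ T c (compRoot∉D̂ rc) c≢r , pc∉X)

  UpPath-parent : ∀ {c v} → IsCompRoot c → UpPath c v → v ≢ r → InTX (p v) → UpPath c (p v)
  UpPath-parent rc (top _) c≢r pc∈TX = ⊥-elim (compRoot-parent∉TX rc c≢r pc∈TX)
  UpPath-parent _ (climb _ _ path) _ _ = path

  compRoot-unique : ∀ {c c' v} → IsCompRoot c → IsCompRoot c' → UpPath c v → UpPath c' v → c ≡ c'
  compRoot-unique _ _ (top _) (top _) = refl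
  compRoot-unique rc _ (top _) (climb _ c≢r path') =
    ⊥-elim (compRoot-parent∉TX rc c≢r (UpPath⇒InTX path'))
  compRoot-unique _ rc' (climb _ c'≢r path) (top _) =
    ⊥-elim (compRoot-parent∉TX rc' c'≢r (UpPath⇒InTX path))
  compRoot-unique rc rc' (climb _ _ path) (climb _ _ path') = compRoot-unique rc rc' path path'

  InComp-unique : ∀ {c c' v} → InComp c v → InComp c' v → c ≡ c'
  InComp-unique (rc , path) (rc' , path') = compRoot-unique rc rc' path path'

  root-anc : ∀ {v} → v ∉ D̂ → AncT r v
  root-anc {v} = spanning T v

  compRootOf : ∀ {v} → AncT r v → InTX v → ∃[ c ] InComp c v
  compRootOf here r∈ = r , (r∈ , inj₁ refl) , top r∈
  compRootOf {v} (up v≢r chain) v∈ with inTX? (p v)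
  ... | yes pv∈ = let (c , rc , path) = compRootOf chain pv∈ in c , rc , climb v∈ v≢r path
  ... | no pv∉ = v , (v∈ , inj₂ (v≢r , pv∉)) , top v∈

  upPath? : ∀ c v → Dec (UpPath c v)
  upPath? c v with v ∈? D̂
  ... | yes v∈D̂ = no λ path → proj₁ (UpPath⇒InTX path) v∈D̂
  ... | no v∉D̂ = along (root-anc v∉D̂)
    where
      along : ∀ {v} → AncT r v → Dec (UpPath c v)
      along {v} chain with inTX? v | c ≟ v
      ... | no v∉ | _ = no λ path → v∉ (UpPath⇒InTX path)
      ... | yes v∈ | yes refl = yes (top v∈)
      along here | yes _ | no c≢r = no λ { (top _) → c≢r refl ; (climb _ r≢r _) → r≢r refl }
      along (up v≢r chain) | yes v∈ | no c≢v with along chain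
      ... | yes path = yes (climb v∈ v≢r path)
      ... | no ¬path = no λ { (top _) → c≢v refl ; (climb _ _ path) → ¬path path }

  isCompRoot? : ∀ c → Dec (IsCompRoot c)
  isCompRoot? c = inTX? c ×-dec ((c ≟ r) ⊎-dec (¬? (c ≟ r) ×-dec ¬? (inTX? (p c))))

  inComp? : ∀ c v → Dec (InComp c v)
  inComp? c v = isCompRoot? c ×-dec upPath? c v

  backEdge? : ∀ u v → Dec (BackEdge u v)
  backEdge? u v = ¬? (u ∈? D̂) ×-dec (¬? (v ∈? D̂) ×-dec (adj? G u v ×-dec ¬? treeEdge?))
    where treeEdge? = (¬? (u ≟ r) ×-dec (p u ≟ v)) ⊎-dec (¬? (v ≟ r) ×-dec (p v ≟ u))

  backConn? : ∀ a b → Dec (BackConn a b)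
  backConn? a b = any? λ u → any? λ v → inComp? a u ×-dec (inComp? b v ×-dec backEdge? u v)

  hasXBelow? : ∀ c → Dec (HasXBelow c)
  hasXBelow? c = any? x∈X×below?
    where
      x∈X×below? : ∀ x → Dec (InX x × AncT c x)
      x∈X×below? x with inX? x
      ... | no x∉X = no λ (x∈X , _) → x∉X x∈X
      ... | yes x∈X with anc? c (root-anc (proj₂ x∈X))
      ...   | yes c≤x = yes (x∈X , c≤x)
      ...   | no c≰x = no λ (_ , c≤x) → c≰x c≤x

  internal? : ∀ c → Dec (Internal c)
  internal? c = isCompRoot? c ×-dec hasXBelow? c

  internal⊎hanging : ∀ {c} → IsCompRoot c → Internal c ⊎ Hanging c
  internal⊎hanging {c} rc with hasXBelow? c
  ... | yes xBelow = inj₁ (rc , xBelow)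
  ... | no ¬xBelow = inj₂ (rc , λ x x∈X c≤x → ¬xBelow (x , x∈X , c≤x))

  UpPath-split : ∀ {c v w} → UpPath c v → AncT w v → UpPath c w ⊎ (c ≢ r × AncT w (p c))
  UpPath-split path here = inj₁ path
  UpPath-split (top _) (up c≢r w≤pc) = inj₂ (c≢r , w≤pc)
  UpPath-split (climb _ _ path) (up _ w≤pv) = UpPath-split path w≤pv

  ancestor-comp-above : ∀ {c h u v} → InComp c v → InComp h u → AncT v u → h ≢ c →
                        AncT c h × HasXBelow c
  ancestor-comp-above {h = h} (rc , pv) (rh , pu) v≤u h≢c with UpPath-split pu v≤u
  ... | inj₁ pv' = ⊥-elim (h≢c (compRoot-unique rh rc pv' pv))
  ... | inj₂ (h≢r , v≤ph) = up h≢r c≤ph , p h , compRoot-parent∈X rh h≢r , c≤ph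
    where c≤ph = Anc-trans (UpPath⇒Anc pv) v≤ph

  adjacent-comps : ∀ {h c u v} → InComp h u → InComp c v → Adj G u v → h ≢ c →
                   (AncT c h × HasXBelow c) ⊎ (AncT h c × HasXBelow h)
  adjacent-comps {u = u} {v} iu iv adj h≢c
    with dfs T u v (proj₁ (InComp⇒InTX iu)) (proj₁ (InComp⇒InTX iv)) adj
  ... | inj₁ u≤v = inj₂ (ancestor-comp-above iu iv u≤v λ c≡h → h≢c (≡-sym c≡h))
  ... | inj₂ v≤u = inj₁ (ancestor-comp-above iv iu v≤u h≢c)

  hanging-adjacent⇒≡ : ∀ {h h' u v} → Hanging h → Hanging h' → InComp h u → InComp h' v →
                       Adj G u v → h ≡ h'
  hanging-adjacent⇒≡ {h} {h'} hh hh' iu iv adj with h ≟ h'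
  ... | yes h≡h' = h≡h'
  ... | no h≢h' with adjacent-comps iu iv adj h≢h'
  ...   | inj₁ (_ , xBelow) = ⊥-elim (Hanging⇒¬HasXBelow hh' xBelow)
  ...   | inj₂ (_ , xBelow) = ⊥-elim (Hanging⇒¬HasXBelow hh xBelow)

  backConn-hanging⇒anc : ∀ {h c} → Hanging h → Internal c → BackConn h c → AncT c h
  backConn-hanging⇒anc hh ic (_ , _ , iu , iv , (_ , _ , adj , _))
    with adjacent-comps iu iv adj (λ { refl → ¬Internal×Hanging ic hh })
  ... | inj₁ (c≤h , _) = c≤h
  ... | inj₂ (_ , xBelow) = ⊥-elim (Hanging⇒¬HasXBelow hh xBelow)

  treeEdge⇒sameComp : ∀ {c c' v w} → InComp c v → InComp c' w → TreeEdge v w → c ≡ c'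
  treeEdge⇒sameComp (rc , pv) (rc' , pw) (inj₁ (v≢r , refl)) =
    compRoot-unique rc rc' (UpPath-parent rc pv v≢r (UpPath⇒InTX pw)) pw
  treeEdge⇒sameComp (rc , pv) (rc' , pw) (inj₂ (w≢r , refl)) =
    compRoot-unique rc rc' pv (UpPath-parent rc' pw w≢r (UpPath⇒InTX pv))

  adjacent⇒backConn : ∀ {c c' v w} → InComp c v → InComp c' w → Adj G v w → c ≢ c' → BackConn c c'
  adjacent⇒backConn iv iw adj c≢c' =
    _ , _ , iv , iw , proj₁ (InComp⇒InTX iv) , proj₁ (InComp⇒InTX iw) , adj ,
    λ tree → c≢c' (treeEdge⇒sameComp iv iw tree)

  BackConn-sym : ∀ {a b} → BackConn a b → BackConn b a
  BackConn-sym (u , v , iu , iv , (u∉ , v∉ , adj , ¬tree)) =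
    v , u , iv , iu , (v∉ , u∉ , Graph.sym G adj , λ tree → ¬tree (swap tree))

  data Represents : Fin n → Fin n → Set where
    comp : ∀ {c v} → Internal c → InComp c v → Represents c v
    vert : ∀ {u} → InD̂D u → Represents u u

  Represents-walk : ∀ {x a b} → Represents x a → Represents x b → W a b
  Represents-walk (comp _ ia) (comp _ ib) = InComp-walk ia ib
  Represents-walk (vert du) (vert _) = stop (proj₂ du)
  Represents-walk (comp ic _) (vert du) = ⊥-elim (compRoot∉D̂ (proj₁ ic) (proj₁ du))
  Represents-walk (vert du) (comp ic _) = ⊥-elim (compRoot∉D̂ (proj₁ ic) (proj₁ du))

  BackConn⇒Walk : ∀ {a b} → BackConn a b → ∃[ u ] ∃[ v ] (InComp a u × InComp b v × W u v)
  BackConn⇒Walk (u , v , iu , iv , (_ , _ , adj , _)) =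
    u , v , iu , iv , step (InTX⇒∉D (InComp⇒InTX iu)) adj (stop (InTX⇒∉D (InComp⇒InTX iv)))

  EdgeTo⇒Walk : ∀ {u h} → u ∉ D → EdgeTo u h → ∃[ v ] (InComp h v × W u v)
  EdgeTo⇒Walk u∉D (v , iv , adj) = v , iv , step u∉D adj (stop (InTX⇒∉D (InComp⇒InTX iv)))

  MEdge⇒Walk : ∀ {x y} → MEdge x y → ∃[ a ] ∃[ b ] (Represents x a × Represents y b × W a b)
  MEdge⇒Walk (e1 ic₁ ic₂ bc) with BackConn⇒Walk bc
  ... | u , v , iu , iv , w = u , v , comp ic₁ iu , comp ic₂ iv , w
  MEdge⇒Walk (e2 _ icₖ ic bcₖ bc _ _) with BackConn⇒Walk bcₖ | BackConn⇒Walk bc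
  ... | u₁ , v₁ , iu₁ , iv₁ , w₁ | u₂ , v₂ , iu₂ , iv₂ , w₂ =
    v₁ , v₂ , comp icₖ iv₁ , comp ic iv₂ , reverseʷ w₁ ++ʷ InComp-walk iu₁ iu₂ ++ʷ w₂
  MEdge⇒Walk (e3 du₁ du₂ adj) = _ , _ , vert du₁ , vert du₂ , step (proj₂ du₁) adj (stop (proj₂ du₂))
  MEdge⇒Walk (e4 ic du et) with EdgeTo⇒Walk (proj₂ du) et
  ... | v , iv , w = v , _ , comp ic iv , vert du , reverseʷ w
  MEdge⇒Walk (e5 du₁ du₂ _ et₁ et₂) with EdgeTo⇒Walk (proj₂ du₁) et₁ | EdgeTo⇒Walk (proj₂ du₂) et₂
  ... | v₁ , iv₁ , w₁ | v₂ , iv₂ , w₂ =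
    _ , _ , vert du₁ , vert du₂ , w₁ ++ʷ InComp-walk iv₁ iv₂ ++ʷ reverseʷ w₂
  MEdge⇒Walk (e6 ic du _ bc et) with BackConn⇒Walk bc | EdgeTo⇒Walk (proj₂ du) et
  ... | x , y , ix , iy , w₁ | v , iv , w₂ =
    x , _ , comp ic ix , vert du , w₁ ++ʷ InComp-walk iy iv ++ʷ reverseʷ w₂

  MConn⇒Walk : ∀ {x z a b} → MConn x z → Represents x a → Represents z b → W a b
  MConn⇒Walk (mstop _) ra rb = Represents-walk ra rb
  MConn⇒Walk (mstep (inj₁ e) rest) ra rb with MEdge⇒Walk e
  ... | _ , _ , ra' , rb' , w = Represents-walk ra ra' ++ʷ w ++ʷ MConn⇒Walk rest rb' rb
  MConn⇒Walk (mstep (inj₂ e) rest) ra rb with MEdge⇒Walk e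
  ... | _ , _ , ra' , rb' , w = Represents-walk ra rb' ++ʷ reverseʷ w ++ʷ MConn⇒Walk rest ra' rb

  MConn-trans : ∀ {x y z} → MConn x y → MConn y z → MConn x z
  MConn-trans (mstop _) q = q
  MConn-trans (mstep e rest) q = mstep e (MConn-trans rest q)

  adjacent⇒MConn : ∀ {x y v w} → Represents x v → Represents y w → Adj G v w → MConn x y
  adjacent⇒MConn {x} {y} (comp ix iv) (comp iy iw) adj with x ≟ y
  ... | yes refl = mstop (inj₂ ix)
  ... | no x≢y = mstep (inj₁ (e1 ix iy (adjacent⇒backConn iv iw adj x≢y))) (mstop (inj₂ iy))
  adjacent⇒MConn (comp ix iv) (vert dy) adj =
    mstep (inj₁ (e4 ix dy (_ , iv , Graph.sym G adj))) (mstop (inj₁ dy))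
  adjacent⇒MConn (vert dx) (comp iy iw) adj = mstep (inj₂ (e4 iy dx (_ , iw , adj))) (mstop (inj₂ iy))
  adjacent⇒MConn (vert dx) (vert dy) adj = mstep (inj₁ (e3 dx dy adj)) (mstop (inj₁ dy))

  Entry : Fin n → Fin n → Set
  Entry h x = (Internal x × BackConn x h) ⊎ (InD̂D x × EdgeTo x h)

  entry : ∀ {x h v w} → Represents x v → Adj G v w → Hanging h → InComp h w → Entry h x
  entry {x} {h} (comp ix iv) adj hh iw with x ≟ h
  ... | yes refl = ⊥-elim (¬Internal×Hanging ix hh)
  ... | no x≢h = inj₁ (ix , adjacent⇒backConn iv iw adj x≢h)
  entry (vert dx) adj _ iw = inj₂ (dx , _ , iw , adj)

  via-topmost : ∀ {h m c} → Hanging h → Internal m → BackConn m h → Internal c → BackConn h c →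
                MConn m c
  via-topmost {h} {m} {c} hh im bcm ic bc
    with topmost? (λ c' → internal? c' ×-dec backConn? h c') (root-anc (compRoot∉D̂ (proj₁ hh)))
  ... | none above = ⊥-elim (above c (ic , bc) (backConn-hanging⇒anc hh ic bc))
  ... | topmost k (ik , bck) _ below = MConn-trans m⇝k k⇝c
    where
      edge-from-k : ∀ {c'} → Internal c' → BackConn h c' → c' ≢ k → MEdge k c'
      edge-from-k ic' bc' = e2 hh ik ic' bck bc' λ c'' ic'' bc'' →
        below c'' (ic'' , bc'') (backConn-hanging⇒anc hh ic'' bc'')

      m⇝k : MConn m k
      m⇝k with m ≟ k
      ... | yes refl = mstop (inj₂ ik)
      ... | no m≢k = mstep (inj₂ (edge-from-k im (BackConn-sym bcm) m≢k)) (mstop (inj₂ ik))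

      k⇝c : MConn k c
      k⇝c with c ≟ k
      ... | yes refl = mstop (inj₂ ic)
      ... | no c≢k = mstep (inj₁ (edge-from-k ic bc c≢k)) (mstop (inj₂ ic))

  exit : ∀ {h x y v w} → Hanging h → Entry h x → InComp h v → Adj G v w → Represents y w → MConn x y
  exit hh (inj₁ (ix , bcx)) iv adj (vert dy) =
    mstep (inj₁ (e6 ix dy hh bcx (_ , iv , Graph.sym G adj))) (mstop (inj₁ dy))
  exit hh (inj₂ (dx , et)) iv adj (vert dy) =
    mstep (inj₁ (e5 dx dy hh et (_ , iv , Graph.sym G adj))) (mstop (inj₁ dy))
  exit hh entered iv adj (comp iy iw)
    with adjacent⇒backConn iv iw adj (λ { refl → ¬Internal×Hanging iy hh })
  exit hh (inj₁ (ix , bcx)) iv adj (comp iy iw) | bc = via-topmost hh ix bcx iy bc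
  exit hh (inj₂ (dx , et)) iv adj (comp iy iw) | bc =
    mstep (inj₂ (e6 iy dx hh (BackConn-sym bc) et)) (mstop (inj₂ iy))

  data Place (w : Fin n) : Set where
    represented : ∀ {x} → Represents x w → Place w
    hanging     : ∀ {h} → Hanging h → InComp h w → Place w

  place : ∀ {w} → w ∉ D → Place w
  place {w} w∉D with w ∈? D̂
  ... | yes w∈D̂ = represented (vert (w∈D̂ , w∉D))
  ... | no w∉D̂ with compRootOf (root-anc w∉D̂) (w∉D̂ , λ w∈X → w∉D (proj₁ w∈X))
  ...   | c , iw with internal⊎hanging (proj₁ iw)
  ...     | inj₁ ic = represented (comp ic iw)
  ...     | inj₂ hc = hanging hc iw

  Represents-rep : ∀ {x t} (S : Piece) → Represents x t → t ∈P S → MConn x (rep S)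
  Represents-rep (comp c _) (comp ix it) it' = subst (MConn _) (InComp-unique it it') (mstop (inj₂ ix))
  Represents-rep (dvert u du) (vert _) refl = mstop (inj₁ du)
  Represents-rep (comp c _) (vert dx) it' = ⊥-elim (proj₁ (InComp⇒InTX it') (proj₁ dx))
  Represents-rep (dvert u du) (comp _ it) refl = ⊥-elim (proj₁ (InComp⇒InTX it) (proj₁ du))

  Hanging⇒∉Piece : ∀ {h t} (S : Piece) → Hanging h → InComp h t → ¬ t ∈P S
  Hanging⇒∉Piece (comp c ic) hh it it' with InComp-unique it it'
  ... | refl = ¬Internal×Hanging ic hh
  Hanging⇒∉Piece (dvert u du) _ it refl = proj₁ (InComp⇒InTX it) (proj₁ du)

  mutual
    walk⇒MConn : ∀ {x v t} (S : Piece) → Represents x v → W v t → t ∈P S → MConn x (rep S)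
    walk⇒MConn S rx (stop _) t∈S = Represents-rep S rx t∈S
    walk⇒MConn S rx (step _ adj walk) t∈S with place (Walk-source∉ walk)
    ... | represented ry = MConn-trans (adjacent⇒MConn rx ry adj) (walk⇒MConn S ry walk t∈S)
    ... | hanging hh iw = hangingWalk⇒MConn S hh iw (entry rx adj hh iw) walk t∈S

    hangingWalk⇒MConn : ∀ {h x v t} (S : Piece) → Hanging h → InComp h v → Entry h x →
                        W v t → t ∈P S → MConn x (rep S)
    hangingWalk⇒MConn S hh iv _ (stop _) t∈S = ⊥-elim (Hanging⇒∉Piece S hh iv t∈S)
    hangingWalk⇒MConn S hh iv entered (step _ adj walk) t∈S with place (Walk-source∉ walk)
    ... | represented ry = MConn-trans (exit hh entered iv adj ry) (walk⇒MConn S ry walk t∈S)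
    ... | hanging hh' iw with hanging-adjacent⇒≡ hh hh' iv iw adj
    ...   | refl = hangingWalk⇒MConn S hh iw entered walk t∈S

  Piece-represents : ∀ {t} (S : Piece) → t ∈P S → Represents (rep S) t
  Piece-represents (comp c ic) it = comp ic it
  Piece-represents (dvert u du) refl = vert du

  rep∈Piece : (S : Piece) → rep S ∈P S
  rep∈Piece (comp c ic) = proj₁ ic , top (proj₁ (proj₁ ic))
  rep∈Piece (dvert u du) = refl

mainTheorem3 : ∀ {n} (G : Graph n) (D̂ D : Subset n) (T : DFSTree G D̂) →
    ConnectedMinus G D̂ →
    (S S' : Setup.Piece G D̂ D T) →
    Setup.ConnInGminusD G D̂ D T S S' ⇔ Setup.MConn G D̂ D T (Setup.rep G D̂ D T S) (Setup.rep G D̂ D T S')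
mainTheorem3 G D̂ D T _ S S' = mk⇔ walk⇒rep rep⇒walk
  where
    open Setup G D̂ D T
    open Reduction G D̂ D T

    walk⇒rep : ConnInGminusD S S' → MConn (rep S) (rep S')
    walk⇒rep (_ , _ , s∈S , s'∈S' , walk) = walk⇒MConn S' (Piece-represents S s∈S) walk s'∈S'

    rep⇒walk : MConn (rep S) (rep S') → ConnInGminusD S S'
    rep⇒walk conn = rep S , rep S' , rep∈Piece S , rep∈Piece S' ,
      MConn⇒Walk conn (Piece-represents S (rep∈Piece S)) (Piece-represents S' (rep∈Piece S'))
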